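{- Let $P\subset\mathbb{R}^d$ be a rational polytope with denominator $D$ and fix $c\in\mathbb{Z}^d$. Then for all sufficiently large integers $t_1,t_2$ with $t_1\equiv t_2\pmod D$, we have $I_M(t_1P,c)=I_M(t_2P,c)$ and $I_m(t_1P,c)=I_m(t_2P,c)$.
   Context: A rational polytope is the convex hull of finitely many points of $\mathbb{Q}^d$; its denominator $D$ is the smallest positive integer such that $DP$ has all vertices in $\mathbb{Z}^d$. With $\ell_c(x)=c^Tx$, the (additive) maximum and minimum integrality gaps of a polytope $Q$ (containing lattice points) are $I_M(Q,c)=\max_{x\in Q}\ell_c(x)-\max_{x\in Q\cap\mathbb{Z}^d}\ell_c(x)$ and $I_m(Q,c)=\min_{x\in Q\cap\mathbb{Z}^d}\ell_c(x)-\min_{x\in Q}\ell_c(x)$. -}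

module Defs where

open import Data.Nat as ℕ using (ℕ; zero; suc)
open import Data.Integer as ℤ using (ℤ; +_)
open import Data.Rational using (ℚ; _/_; 0ℚ; 1ℚ; _+_; _*_; _-_; _≤_; _<_)
open import Data.Fin using (Fin; zero; suc)
open import Data.Product using (Σ; ∃; _×_; _,_)
open import Relation.Binary.PropositionalEquality using (_≡_)

Pt : ℕ → Set
Pt d = Fin d → ℚ

LPt : ℕ → Set
LPt d = Fin d → ℤ

Σ[<] : (n : ℕ) → (Fin n → ℚ) → ℚ
Σ[<] zero    f = 0ℚ
Σ[<] (suc n) f = f zero + Σ[<] n (λ i → f (suc i))

ℤ→ℚ : ℤ → ℚ
ℤ→ℚ z = z / 1

embed : ∀ {d} → LPt d → Pt d
embed z j = ℤ→ℚ (z j)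

IsInt : ℚ → Set
IsInt q = ∃ λ (z : ℤ) → q ≡ ℤ→ℚ z

ℓ : ∀ {d} → LPt d → Pt d → ℚ
ℓ {d} c x = Σ[<] d (λ j → ℤ→ℚ (c j) * x j)

Region : ℕ → Set₁
Region d = Pt d → Set

InConv : ∀ {d k} → (Fin k → Pt d) → Region d
InConv {d} {k} vs x =
  Σ (Fin k → ℚ) λ w →
    (∀ i → 0ℚ ≤ w i) × (Σ[<] k w ≡ 1ℚ) ×
    (∀ j → x j ≡ Σ[<] k (λ i → w i * vs i j))

Dilate : ∀ {d} → ℕ → Region d → Region d
Dilate t Q x = Σ (Pt _) λ y → Q y × (∀ j → x j ≡ ℤ→ℚ (+ t) * y j)

IsVertex : ∀ {d} → Region d → Pt d → Set
IsVertex Q v =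
  Q v ×
  (∀ x y (lam : ℚ) → Q x → Q y → 0ℚ < lam → lam < 1ℚ →
     (∀ j → v j ≡ lam * x j + (1ℚ - lam) * y j) → ∀ j → x j ≡ v j)

ClearsDenoms : ∀ {d} → Region d → ℕ → Set
ClearsDenoms Q D = ∀ v → IsVertex Q v → ∀ j → IsInt (ℤ→ℚ (+ D) * v j)

IsDenominator : ∀ {d} → Region d → ℕ → Set
IsDenominator Q D =
  (0 ℕ.< D) × ClearsDenoms Q D × (∀ D′ → 0 ℕ.< D′ → ClearsDenoms Q D′ → D ℕ.≤ D′)

IsMaxVal : ∀ {d} → Region d → LPt d → ℚ → Set
IsMaxVal Q c M = (∃ λ x → Q x × ℓ c x ≡ M) × (∀ x → Q x → ℓ c x ≤ M)

IsMinVal : ∀ {d} → Region d → LPt d → ℚ → Set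
IsMinVal Q c m = (∃ λ x → Q x × ℓ c x ≡ m) × (∀ x → Q x → m ≤ ℓ c x)

IsLatMaxVal : ∀ {d} → Region d → LPt d → ℚ → Set
IsLatMaxVal Q c L =
  (∃ λ z → Q (embed z) × ℓ c (embed z) ≡ L) × (∀ z → Q (embed z) → ℓ c (embed z) ≤ L)

IsLatMinVal : ∀ {d} → Region d → LPt d → ℚ → Set
IsLatMinVal Q c l =
  (∃ λ z → Q (embed z) × ℓ c (embed z) ≡ l) × (∀ z → Q (embed z) → l ≤ ℓ c (embed z))

IsMaxGap : ∀ {d} → Region d → LPt d → ℚ → Set
IsMaxGap Q c g = ∃ λ M → ∃ λ L → IsMaxVal Q c M × IsLatMaxVal Q c L × g ≡ M - L

IsMinGap : ∀ {d} → Region d → LPt d → ℚ → Set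
IsMinGap Q c g = ∃ λ m → ∃ λ l → IsMinVal Q c m × IsLatMinVal Q c l × g ≡ l - m

-- Fourier–Motzkin elimination makes membership in the convex hull of finitely many rational
-- points decidable, so one can prune the generators of P to an irredundant subfamily V that
-- still spans P; its members are vertices, hence D·v is integral for v ∈ V. Points of tP are
-- the nonnegative combinations of V of total weight t. Adding D·v*, for v* ∈ V maximising c,
-- maps tP into (t+D)P and lattice points to lattice points, raising c by D·c(v*). Conversely,
-- once t ≥ (k+1)D every point of (t+D)P has weight at least D on some v ∈ V, and subtracting
-- D·v lands in tP while lowering c by at most D·c(v*). So from t to t+D both the LP maximum and
-- the lattice maximum grow by exactly D·c(v*); the maximum gap is D-periodic from (k+1)D on, and
-- the minimum gap is the maximum gap for -c.
module Submission where

open import Defs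
open import Algebra.Properties.Group using (⁻¹-involutive)
open import Data.Fin using (Fin; zero; suc; _≟_)
open import Data.Fin.Properties using (any?)
open import Data.Fin.Subset using (Subset; _∈_; _∉_; _⊆_; ⊤; ∣_∣) renaming (_-_ to _∖_)
open import Data.Fin.Subset.Properties using (_∈?_; ∈⊤; ∣p∣≤n; p─q⊆p; x∈p∧x≢y⇒x∈p-y; x∈p⇒∣p-x∣<∣p∣)
open import Data.Integer as ℤ using (ℤ; -[1+_])
import Data.Integer.Properties as ℤ
open import Data.Integer.Divisibility using () renaming (_∣_ to _∣ℤ_)
open import Data.List using (List; []; _∷_; _++_; map; foldr; filter; tabulate; allFin; cartesianProductWith)
open import Data.List.Membership.Propositional as List using ()
open import Data.List.Membership.Propositional.Properties
  using (∈-cartesianProductWith⁺; ∈-cartesianProductWith⁻; ∈-filter⁺; ∈-allFin)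
open import Data.List.Relation.Unary.All as All using (All; []; _∷_)
import Data.List.Relation.Unary.All.Properties as All
open import Data.Nat as ℕ using (ℕ; zero; suc)
import Data.Nat.Coprimality as Coprimality
open import Data.Nat.Divisibility using (divides) renaming (_∣_ to _ℕ∣_)
import Data.Nat.Properties as ℕ
open import Data.Product using (Σ; ∃; _×_; _,_; proj₁; proj₂)
open import Data.Rational
  using (ℚ; mkℚ; _/_; 0ℚ; 1ℚ; _+_; _*_; _-_; -_; _≤_; _<_; 1/_; positive; nonNegative; >-nonZero)
open import Data.Rational.Properties hiding (_≟_)
open import Data.Rational.Solver using (module +-*-Solver)
open import Data.Sum using ([_,_]′)
open import Data.Vec.Base using (_∷_; here; there)
open import Data.Vec.Functional as Vector using (head; tail)
open import Function using (_∘_)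
open import Function.Bundles using (_⇔_; mk⇔; Equivalence)
import Function.Properties.Equivalence as ⇔
open import Relation.Binary using (DecTotalOrder; Tri; tri<; tri≈; tri>)
open import Data.List.Extrema (DecTotalOrder.totalOrder ≤-decTotalOrder)
  using (max; min; max≤v⁺; min≤xs; xs≤max; argmax; argmax-all; f[xs]≤f[argmax])
open import Relation.Binary.PropositionalEquality
open import Relation.Nullary using (¬_; yes; no; contradiction)
open import Relation.Nullary.Decidable as Dec using (Dec; map′; _×-dec_)

open Equivalence using (to; from)
open +-*-Solver

neg-involutive : ∀ p → - (- p) ≡ p
neg-involutive = ⁻¹-involutive +-0-group

ℕ→ℚ : ℕ → ℚ
ℕ→ℚ n = ℤ→ℚ (ℤ.+ n)

coprime-to-1 : ∀ n → Coprimality.Coprime n 1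
coprime-to-1 n = Coprimality.sym (Coprimality.1-coprimeTo n)

ℤ→ℚ≡mkℚ : ∀ z → ℤ→ℚ z ≡ mkℚ z 0 (coprime-to-1 ℤ.∣ z ∣)
ℤ→ℚ≡mkℚ (ℤ.+ n)  = normalize-coprime (coprime-to-1 n)
ℤ→ℚ≡mkℚ -[1+ n ] = cong -_ (normalize-coprime (coprime-to-1 (suc n)))

ℤ→ℚ-homo-+ : ∀ a b → ℤ→ℚ (a ℤ.+ b) ≡ ℤ→ℚ a + ℤ→ℚ b
ℤ→ℚ-homo-+ a b = sym (begin
  ℤ→ℚ a + ℤ→ℚ b                      ≡⟨ cong₂ _+_ (ℤ→ℚ≡mkℚ a) (ℤ→ℚ≡mkℚ b) ⟩
  (a ℤ.* ℤ.+ 1 ℤ.+ b ℤ.* ℤ.+ 1) / 1  ≡⟨ cong (_/ 1) (cong₂ ℤ._+_ (ℤ.*-identityʳ a) (ℤ.*-identityʳ b)) ⟩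
  ℤ→ℚ (a ℤ.+ b)                      ∎)
  where open ≡-Reasoning

ℤ→ℚ-homo‿- : ∀ a → ℤ→ℚ (ℤ.- a) ≡ - ℤ→ℚ a
ℤ→ℚ-homo‿- (ℤ.+ zero)  = refl
ℤ→ℚ-homo‿- (ℤ.+ suc n) = refl
ℤ→ℚ-homo‿- -[1+ n ]   = trans (ℤ→ℚ≡mkℚ (ℤ.+ suc n)) (sym (cong -_ (ℤ→ℚ≡mkℚ -[1+ n ])))

ℕ→ℚ-homo-+ : ∀ m n → ℕ→ℚ (m ℕ.+ n) ≡ ℕ→ℚ m + ℕ→ℚ n
ℕ→ℚ-homo-+ m n = ℤ→ℚ-homo-+ (ℤ.+ m) (ℤ.+ n)

ℕ→ℚ-nonNeg : ∀ n → 0ℚ ≤ ℕ→ℚ n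
ℕ→ℚ-nonNeg n = nonNegative⁻¹ (ℕ→ℚ n) {{normalize-nonNeg n 1}}

ℕ→ℚ-pos : ∀ n .{{_ : ℕ.NonZero n}} → 0ℚ < ℕ→ℚ n
ℕ→ℚ-pos (suc n) = positive⁻¹ (ℕ→ℚ (suc n)) {{normalize-pos (suc n) 1}}

ℕ→ℚ-mono-≤ : ∀ {m n} → m ℕ.≤ n → ℕ→ℚ m ≤ ℕ→ℚ n
ℕ→ℚ-mono-≤ {m} {n} m≤n = begin
  ℕ→ℚ m                      ≡⟨ +-identityʳ (ℕ→ℚ m) ⟨
  ℕ→ℚ m + 0ℚ                 ≤⟨ +-monoʳ-≤ (ℕ→ℚ m) (ℕ→ℚ-nonNeg (n ℕ.∸ m)) ⟩
  ℕ→ℚ m + ℕ→ℚ (n ℕ.∸ m)      ≡⟨ ℕ→ℚ-homo-+ m (n ℕ.∸ m) ⟨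
  ℕ→ℚ (m ℕ.+ (n ℕ.∸ m))      ≡⟨ cong ℕ→ℚ (ℕ.m+[n∸m]≡n m≤n) ⟩
  ℕ→ℚ n                      ∎
  where open ≤-Reasoning

recip : (p : ℚ) → 0ℚ < p → ℚ
recip p 0<p = (1/ p) {{>-nonZero 0<p}}

recip-pos : ∀ {p} (0<p : 0ℚ < p) → 0ℚ < recip p 0<p
recip-pos {p} 0<p = positive⁻¹ _ {{1/pos⇒pos p {{positive 0<p}}}}

recip-inverseˡ : ∀ {p} (0<p : 0ℚ < p) → recip p 0<p * p ≡ 1ℚ
recip-inverseˡ {p} 0<p = *-inverseˡ p {{>-nonZero 0<p}}

*-monoˡ-≤-pos-⇔ : ∀ {s} → 0ℚ < s → ∀ {u v} → u ≤ v ⇔ s * u ≤ s * v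
*-monoˡ-≤-pos-⇔ {s} 0<s = mk⇔ (*-monoˡ-≤-nonNeg s {{nonNegative (<⇒≤ 0<s)}}) (*-cancelˡ-≤-pos s {{positive 0<s}})

≤-congˡ-⇔ : ∀ {u u′ v} → u ≡ u′ → (u ≤ v) ⇔ (u′ ≤ v)
≤-congˡ-⇔ refl = ⇔.refl

≤-addʳ : ∀ c {a b a′ b′} → a + c ≡ a′ → b + c ≡ b′ → a ≤ b → a′ ≤ b′
≤-addʳ c refl refl a≤b = +-monoˡ-≤ c a≤b

+-≤⇔≤- : ∀ u w v → u + w ≤ v ⇔ u ≤ v - w
+-≤⇔≤- u w v = mk⇔
  (≤-addʳ (- w) (solve 2 (λ u w → (u :+ w) :- w := u) refl u w) refl)
  (≤-addʳ w refl (solve 2 (λ v w → (v :- w) :+ w := v) refl v w))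

-+-≤⇔-≤ : ∀ u w v → - u + w ≤ v ⇔ w - v ≤ u
-+-≤⇔-≤ u w v = mk⇔
  (≤-addʳ (u - v) (solve 3 (λ u w v → (:- u :+ w) :+ (u :- v) := w :- v) refl u w v)
                  (solve 2 (λ u v → v :+ (u :- v) := u) refl u v))
  (≤-addʳ (- u + v) (solve 3 (λ u w v → (w :- v) :+ (:- u :+ v) := :- u :+ w) refl u w v)
                    (solve 2 (λ u v → u :+ (:- u :+ v) := v) refl u v))

neg-≤-⇔ : ∀ p q → - p ≤ - q ⇔ q ≤ p
neg-≤-⇔ p q = mk⇔ (λ -p≤-q → subst₂ _≤_ (neg-involutive q) (neg-involutive p) (neg-antimono-≤ -p≤-q))
                  neg-antimono-≤

p<q⇒0<q-p : ∀ {p q} → p < q → 0ℚ < q - p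
p<q⇒0<q-p {p} {q} p<q = subst (_< q - p) (+-inverseʳ p) (+-monoˡ-< (- p) p<q)

*-nonNeg : ∀ {p q} → 0ℚ ≤ p → 0ℚ ≤ q → 0ℚ ≤ p * q
*-nonNeg {p} {q} 0≤p 0≤q = subst (_≤ p * q) (*-zeroʳ p) (*-monoˡ-≤-nonNeg p {{nonNegative 0≤p}} 0≤q)

convex-combination-≡1 : ∀ {t a b} → 0ℚ < t → t < 1ℚ → a ≤ 1ℚ → b ≤ 1ℚ → t * a + (1ℚ - t) * b ≡ 1ℚ → a ≡ 1ℚ
convex-combination-≡1 {t} {a} {b} 0<t t<1 a≤1 b≤1 t*a+[1-t]*b≡1 = ≤-antisym a≤1 (≮⇒≥ a≮1)
  where
  a≮1 : ¬ a < 1ℚ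
  a≮1 a<1 = <-irrefl t*a+[1-t]*b≡1 (begin-strict
    t * a + (1ℚ - t) * b     <⟨ +-mono-<-≤ (*-monoʳ-<-pos t {{positive 0<t}} a<1)
                                           (*-monoˡ-≤-nonNeg (1ℚ - t) {{nonNegative (<⇒≤ (p<q⇒0<q-p t<1))}} b≤1) ⟩
    t * 1ℚ + (1ℚ - t) * 1ℚ   ≡⟨ solve 1 (λ t → t :* con 1ℚ :+ (con 1ℚ :- t) :* con 1ℚ := con 1ℚ) refl t ⟩
    1ℚ                       ∎)
    where open ≤-Reasoning

+-cancelʳ-≤ : ∀ c {a b} → a + c ≤ b + c → a ≤ b
+-cancelʳ-≤ c {a} {b} =
  ≤-addʳ (- c) (solve 2 (λ a c → (a :+ c) :- c := a) refl a c) (solve 2 (λ b c → (b :+ c) :- c := b) refl b c)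

Σ[<]-cong : ∀ n {f g : Fin n → ℚ} → f ≗ g → Σ[<] n f ≡ Σ[<] n g
Σ[<]-cong zero    f≗g = refl
Σ[<]-cong (suc n) f≗g = cong₂ _+_ (f≗g zero) (Σ[<]-cong n (f≗g ∘ suc))

Σ[<]-zero : ∀ n → Σ[<] n (λ _ → 0ℚ) ≡ 0ℚ
Σ[<]-zero zero    = refl
Σ[<]-zero (suc n) = trans (cong (0ℚ +_) (Σ[<]-zero n)) (+-identityˡ 0ℚ)

Σ[<]-distrib-+ : ∀ n (f g : Fin n → ℚ) → Σ[<] n (λ i → f i + g i) ≡ Σ[<] n f + Σ[<] n g
Σ[<]-distrib-+ zero    f g = sym (+-identityˡ 0ℚ)
Σ[<]-distrib-+ (suc n) f g = trans (cong (f zero + g zero +_) (Σ[<]-distrib-+ n (f ∘ suc) (g ∘ suc)))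
  (solve 4 (λ a b c d → (a :+ b) :+ (c :+ d) := (a :+ c) :+ (b :+ d)) refl (f zero) (g zero) _ _)

*-distribˡ-Σ[<] : ∀ n a (f : Fin n → ℚ) → Σ[<] n (λ i → a * f i) ≡ a * Σ[<] n f
*-distribˡ-Σ[<] zero    a f = sym (*-zeroʳ a)
*-distribˡ-Σ[<] (suc n) a f =
  trans (cong (a * f zero +_) (*-distribˡ-Σ[<] n a (f ∘ suc))) (sym (*-distribˡ-+ a (f zero) _))

neg-distrib-Σ[<] : ∀ n (f : Fin n → ℚ) → Σ[<] n (λ i → - f i) ≡ - Σ[<] n f
neg-distrib-Σ[<] zero    f = refl
neg-distrib-Σ[<] (suc n) f =
  trans (cong (- f zero +_) (neg-distrib-Σ[<] n (f ∘ suc))) (sym (neg-distrib-+ (f zero) _))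

Σ[<]-mono-≤ : ∀ n {f g : Fin n → ℚ} → (∀ i → f i ≤ g i) → Σ[<] n f ≤ Σ[<] n g
Σ[<]-mono-≤ zero    f≤g = ≤-refl
Σ[<]-mono-≤ (suc n) f≤g = +-mono-≤ (f≤g zero) (Σ[<]-mono-≤ n (f≤g ∘ suc))

Σ[<]-nonNeg : ∀ n {f : Fin n → ℚ} → (∀ i → 0ℚ ≤ f i) → 0ℚ ≤ Σ[<] n f
Σ[<]-nonNeg n {f} 0≤f = subst (_≤ Σ[<] n f) (Σ[<]-zero n) (Σ[<]-mono-≤ n 0≤f)

term≤Σ[<] : ∀ n {f : Fin n → ℚ} → (∀ i → 0ℚ ≤ f i) → ∀ i → f i ≤ Σ[<] n f
term≤Σ[<] (suc n) {f} 0≤f zero = begin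
  f zero            ≡⟨ +-identityʳ (f zero) ⟨
  f zero + 0ℚ       ≤⟨ +-monoʳ-≤ (f zero) (Σ[<]-nonNeg n (0≤f ∘ suc)) ⟩
  Σ[<] (suc n) f    ∎
  where open ≤-Reasoning
term≤Σ[<] (suc n) {f} 0≤f (suc i) = begin
  f (suc i)                      ≤⟨ term≤Σ[<] n (0≤f ∘ suc) i ⟩
  Σ[<] n (f ∘ suc)               ≡⟨ +-identityˡ _ ⟨
  0ℚ + Σ[<] n (f ∘ suc)          ≤⟨ +-monoˡ-≤ (Σ[<] n (f ∘ suc)) (0≤f zero) ⟩
  Σ[<] (suc n) f                 ∎
  where open ≤-Reasoning

single : ∀ {n} → Fin n → ℚ → Fin n → ℚ
single zero    a zero    = a
single zero    a (suc l) = 0ℚ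
single (suc i) a zero    = 0ℚ
single (suc i) a (suc l) = single i a l

single-≡ : ∀ {n} (i : Fin n) a → single i a i ≡ a
single-≡ zero    a = refl
single-≡ (suc i) a = single-≡ i a

single-≢ : ∀ {n} (i l : Fin n) a → l ≢ i → single i a l ≡ 0ℚ
single-≢ zero    zero    a l≢i = contradiction refl l≢i
single-≢ zero    (suc l) a l≢i = refl
single-≢ (suc i) zero    a l≢i = refl
single-≢ (suc i) (suc l) a l≢i = single-≢ i l a (l≢i ∘ cong suc)

Σ[<]-single-* : ∀ n (i : Fin n) a (f : Fin n → ℚ) → Σ[<] n (λ l → single i a l * f l) ≡ a * f i
Σ[<]-single-* (suc n) zero a f = begin
  a * f zero + Σ[<] n (λ l → 0ℚ * f (suc l))  ≡⟨ cong (a * f zero +_) (Σ[<]-cong n (λ l → *-zeroˡ (f (suc l)))) ⟩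
  a * f zero + Σ[<] n (λ _ → 0ℚ)              ≡⟨ cong (a * f zero +_) (Σ[<]-zero n) ⟩
  a * f zero + 0ℚ                             ≡⟨ +-identityʳ _ ⟩
  a * f zero                                  ∎
  where open ≡-Reasoning
Σ[<]-single-* (suc n) (suc i) a f = begin
  0ℚ * f zero + Σ[<] n (λ l → single i a l * f (suc l))  ≡⟨ cong (_+ Σ[<] n (λ l → single i a l * f (suc l))) (*-zeroˡ (f zero)) ⟩
  0ℚ + Σ[<] n (λ l → single i a l * f (suc l))           ≡⟨ +-identityˡ _ ⟩
  Σ[<] n (λ l → single i a l * f (suc l))                ≡⟨ Σ[<]-single-* n i a (f ∘ suc) ⟩
  a * f (suc i)                                          ∎
  where open ≡-Reasoning

Σ[<]-single : ∀ n (i : Fin n) a → Σ[<] n (single i a) ≡ a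
Σ[<]-single n i a = begin
  Σ[<] n (single i a)                  ≡⟨ Σ[<]-cong n (λ l → *-identityʳ (single i a l)) ⟨
  Σ[<] n (λ l → single i a l * 1ℚ)     ≡⟨ Σ[<]-single-* n i a (λ _ → 1ℚ) ⟩
  a * 1ℚ                               ≡⟨ *-identityʳ a ⟩
  a                                    ∎
  where open ≡-Reasoning

Σ[<]-const : ∀ n m → Σ[<] n (λ _ → ℕ→ℚ m) ≡ ℕ→ℚ (n ℕ.* m)
Σ[<]-const zero    m = refl
Σ[<]-const (suc n) m = trans (cong (ℕ→ℚ m +_) (Σ[<]-const n m)) (sym (ℕ→ℚ-homo-+ m (n ℕ.* m)))

pigeonhole : ∀ n (f g : Fin n → ℚ) → Σ[<] n g < Σ[<] n f → ∃ λ i → g i < f i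
pigeonhole n f g Σg<Σf with any? (λ i → g i <? f i)
... | yes found = found
... | no none   = contradiction (<-≤-trans Σg<Σf Σf≤Σg) (<-irrefl refl)
  where
  Σf≤Σg : Σ[<] n f ≤ Σ[<] n g
  Σf≤Σg = Σ[<]-mono-≤ n (λ i → ≮⇒≥ (λ gᵢ<fᵢ → none (i , gᵢ<fᵢ)))

argmax-on : ∀ {n} (f : Fin n → ℚ) {S : Subset n} {i₀} → i₀ ∈ S → ∃ λ i → i ∈ S × (∀ {l} → l ∈ S → f l ≤ f i)
argmax-on {n} f {S} {i₀} i₀∈S =
  argmax f i₀ xs ,
  argmax-all f i₀∈S (All.all-filter (_∈? S) (allFin n)) ,
  λ l∈S → All.lookup (f[xs]≤f[argmax] {f = f} i₀ xs) (∈-filter⁺ (_∈? S) (∈-allFin _) l∈S)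
  where
  xs = filter (_∈? S) (allFin n)

-- Linear inequalities and Fourier–Motzkin elimination

infix 7 _·_
_·_ : ∀ {n} → (Fin n → ℚ) → (Fin n → ℚ) → ℚ
a · x = Σ[<] _ (λ i → a i * x i)

·-distribʳ-+ : ∀ {n} (a b x : Fin n → ℚ) → (λ i → a i + b i) · x ≡ a · x + b · x
·-distribʳ-+ {n} a b x = trans (Σ[<]-cong n (λ i → *-distribʳ-+ (x i) (a i) (b i))) (Σ[<]-distrib-+ n _ _)

·-scale : ∀ {n} s (a x : Fin n → ℚ) → (λ i → s * a i) · x ≡ s * (a · x)
·-scale {n} s a x = trans (Σ[<]-cong n (λ i → *-assoc s (a i) (x i))) (*-distribˡ-Σ[<] n s _)

·-head-tail : ∀ {n} s (a x : Fin (suc n) → ℚ) →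
  s * (a · x) ≡ (s * head a) * head x + (λ i → s * tail a i) · tail x
·-head-tail s a x = begin
  s * (head a * head x + tail a · tail x)         ≡⟨ *-distribˡ-+ s _ _ ⟩
  s * (head a * head x) + s * (tail a · tail x)   ≡⟨ cong₂ _+_ (sym (*-assoc s _ _)) (sym (·-scale s (tail a) (tail x))) ⟩
  (s * head a) * head x + (λ i → s * tail a i) · tail x ∎
  where open ≡-Reasoning

Inequality : ℕ → Set
Inequality n = (Fin n → ℚ) × ℚ

infix 4 _⊨_
_⊨_ : ∀ {n} → (Fin n → ℚ) → Inequality n → Set
x ⊨ r = proj₁ r · x ≤ proj₂ r

Feasible : ∀ {n} → List (Inequality n) → Set
Feasible {n} rs = ∃ λ (x : Fin n → ℚ) → All (x ⊨_) rs

·-neg : ∀ {n} (a x : Fin n → ℚ) → (λ i → - a i) · x ≡ - (a · x)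
·-neg {n} a x = trans (Σ[<]-cong n (λ i → sym (neg-distribˡ-* (a i) (x i)))) (neg-distrib-Σ[<] n _)

·-single : ∀ {n} i a (x : Fin n → ℚ) → single i a · x ≡ a * x i
·-single {n} i a x = Σ[<]-single-* n i a x

equalities : ∀ {n} → List (Inequality n) → List (Inequality n)
equalities []             = []
equalities ((a , b) ∷ es) = (a , b) ∷ ((λ i → - a i) , - b) ∷ equalities es

equalities-⇔ : ∀ {n} (x : Fin n → ℚ) es → All (x ⊨_) (equalities es) ⇔ All (λ e → proj₁ e · x ≡ proj₂ e) es
equalities-⇔ x []             = mk⇔ (λ _ → []) (λ _ → [])
equalities-⇔ x ((a , b) ∷ es) = mk⇔
  (λ { (a·x≤b ∷ -a·x≤-b ∷ hs) → ≤-antisym a·x≤b (to (neg-≤-⇔ _ _) (subst (_≤ - b) (·-neg a x) -a·x≤-b))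
                                ∷ to (equalities-⇔ x es) hs })
  (λ { (a·x≡b ∷ hs) → ≤-reflexive a·x≡b ∷ ≤-reflexive (trans (·-neg a x) (cong -_ a·x≡b))
                      ∷ from (equalities-⇔ x es) hs })

module FourierMotzkin where

  upperBound lowerBound : ∀ {n} → (Fin n → ℚ) → Inequality n → ℚ
  upperBound x (a , b) = b - a · x
  lowerBound x (a , b) = a · x - b

  scaledTail : ∀ {n} → ℚ → Inequality (suc n) → Inequality n
  scaledTail s (a , b) = (λ i → s * tail a i) , s * b

  module _ {n} (x : Fin (suc n) → ℚ) (a : Fin (suc n) → ℚ) (b : ℚ) where

    upper-⇔ : (0<a₀ : 0ℚ < head a) → x ⊨ (a , b) ⇔ head x ≤ upperBound (tail x) (scaledTail (recip _ 0<a₀) (a , b))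
    upper-⇔ 0<a₀ = ⇔.trans (*-monoˡ-≤-pos-⇔ (recip-pos 0<a₀))
      (⇔.trans (≤-congˡ-⇔ (sym normalised)) (+-≤⇔≤- (head x) _ (s * b)))
      where
      s = recip _ 0<a₀
      w = (λ i → s * tail a i) · tail x
      normalised : head x + w ≡ s * (a · x)
      normalised = sym (trans (·-head-tail s a x)
        (trans (cong (λ c → c * head x + w) (recip-inverseˡ 0<a₀)) (cong (_+ w) (*-identityˡ (head x)))))

    lower-⇔ : (a₀<0 : head a < 0ℚ) →
      x ⊨ (a , b) ⇔ lowerBound (tail x) (scaledTail (recip _ (neg-antimono-< a₀<0)) (a , b)) ≤ head x
    lower-⇔ a₀<0 = ⇔.trans (*-monoˡ-≤-pos-⇔ (recip-pos (neg-antimono-< a₀<0)))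
      (⇔.trans (≤-congˡ-⇔ (sym normalised)) (-+-≤⇔-≤ (head x) _ (s * b)))
      where
      s = recip _ (neg-antimono-< a₀<0)
      s*a₀≡-1 : s * head a ≡ - 1ℚ
      s*a₀≡-1 = begin
        s * head a         ≡⟨ solve 2 (λ s a → s :* a := :- (s :* (:- a))) refl s (head a) ⟩
        - (s * - head a)   ≡⟨ cong -_ (recip-inverseˡ (neg-antimono-< a₀<0)) ⟩
        - 1ℚ               ∎
        where open ≡-Reasoning
      w = (λ i → s * tail a i) · tail x
      normalised : - head x + w ≡ s * (a · x)
      normalised = sym (trans (·-head-tail s a x)
        (trans (cong (λ c → c * head x + w) s*a₀≡-1)
               (cong (_+ w) (solve 1 (λ x → :- con 1ℚ :* x := :- x) refl (head x)))))

    other-⇔ : head a ≡ 0ℚ → x ⊨ (a , b) ⇔ tail x ⊨ (tail a , b)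
    other-⇔ a₀≡0 = ≤-congˡ-⇔ drop-head
      where
      drop-head : a · x ≡ tail a · tail x
      drop-head = trans (cong (λ c → c * head x + tail a · tail x) a₀≡0)
        (trans (cong (_+ tail a · tail x) (*-zeroˡ (head x))) (+-identityˡ _))

  record Partition (n : ℕ) : Set where
    field
      uppers lowers others : List (Inequality n)
  open Partition

  Holds : ∀ {n} → ℚ → (Fin n → ℚ) → Partition n → Set
  Holds x₀ x p = All (λ r → x₀ ≤ upperBound x r) (uppers p)
               × All (λ r → lowerBound x r ≤ x₀) (lowers p)
               × All (x ⊨_) (others p)

  insert : ∀ {n} → Inequality (suc n) → Partition n → Partition n
  insert (a , b) p with <-cmp (head a) 0ℚ
  ... | tri< a₀<0 _ _ = record p { lowers = scaledTail (recip _ (neg-antimono-< a₀<0)) (a , b) ∷ lowers p }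
  ... | tri≈ _ _ _    = record p { others = (tail a , b) ∷ others p }
  ... | tri> _ _ 0<a₀ = record p { uppers = scaledTail (recip _ 0<a₀) (a , b) ∷ uppers p }

  insert-⇔ : ∀ {n} (x : Fin (suc n) → ℚ) r (p : Partition n) →
    (x ⊨ r × Holds (head x) (tail x) p) ⇔ Holds (head x) (tail x) (insert r p)
  insert-⇔ x (a , b) p with <-cmp (head a) 0ℚ
  ... | tri< a₀<0 _ _ = mk⇔ (λ (h , U , L , O) → U , to (lower-⇔ x a b a₀<0) h ∷ L , O)
                            (λ { (U , h ∷ L , O) → from (lower-⇔ x a b a₀<0) h , U , L , O })
  ... | tri≈ _ a₀≡0 _ = mk⇔ (λ (h , U , L , O) → U , L , to (other-⇔ x a b a₀≡0) h ∷ O)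
                            (λ { (U , L , h ∷ O) → from (other-⇔ x a b a₀≡0) h , U , L , O })
  ... | tri> _ _ 0<a₀ = mk⇔ (λ (h , U , L , O) → to (upper-⇔ x a b 0<a₀) h ∷ U , L , O)
                            (λ { (h ∷ U , L , O) → from (upper-⇔ x a b 0<a₀) h , U , L , O })

  partition : ∀ {n} → List (Inequality (suc n)) → Partition n
  partition = foldr insert (record { uppers = [] ; lowers = [] ; others = [] })

  partition-⇔ : ∀ {n} (x : Fin (suc n) → ℚ) rs → All (x ⊨_) rs ⇔ Holds (head x) (tail x) (partition rs)
  partition-⇔ x []       = mk⇔ (λ _ → [] , [] , []) (λ _ → [])
  partition-⇔ x (r ∷ rs) = ⇔.trans
    (mk⇔ (λ { (h ∷ hs) → h , to (partition-⇔ x rs) hs }) (λ (h , H) → h ∷ from (partition-⇔ x rs) H))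
    (insert-⇔ x r (partition rs))

  _⊕_ : ∀ {n} → Inequality n → Inequality n → Inequality n
  (a , b) ⊕ (a′ , b′) = (λ i → a i + a′ i) , b + b′

  ⊕-⇔ : ∀ {n} (x : Fin n → ℚ) u l → x ⊨ u ⊕ l ⇔ lowerBound x l ≤ upperBound x u
  ⊕-⇔ x (a , b) (a′ , b′) = ⇔.trans (≤-congˡ-⇔ (·-distribʳ-+ a a′ x)) (mk⇔
    (≤-addʳ (- b′ - a · x) (solve 3 (λ u v c → (u :+ v) :+ (:- c :- u) := v :- c) refl (a · x) (a′ · x) b′)
                           (solve 3 (λ b c u → (b :+ c) :+ (:- c :- u) := b :- u) refl b b′ (a · x)))
    (≤-addʳ (b′ + a · x) (solve 3 (λ u v c → (v :- c) :+ (c :+ u) := u :+ v) refl (a · x) (a′ · x) b′)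
                         (solve 3 (λ b c u → (b :- u) :+ (c :+ u) := b :+ c) refl b b′ (a · x))))

  -- The projection of the solution set along the first variable is cut out by the rows free of
  -- it together with all sums of a normalised upper and a normalised lower bound.
  project : ∀ {n} → Partition n → List (Inequality n)
  project p = others p ++ cartesianProductWith _⊕_ (uppers p) (lowers p)

  project-sound : ∀ {n} x₀ (x : Fin n → ℚ) p → Holds x₀ x p → All (x ⊨_) (project p)
  project-sound x₀ x p (U , L , O) = All.++⁺ O (All.tabulate λ v∈ →
    let (u , l , u∈ , l∈ , v≡u⊕l) = ∈-cartesianProductWith⁻ _⊕_ (uppers p) (lowers p) v∈ in
    subst (x ⊨_) (sym v≡u⊕l) (from (⊕-⇔ x u l) (≤-trans (All.lookup L l∈) (All.lookup U u∈))))

  -- Any value between the largest lower and the smallest upper bound will do; 0ℚ only matters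
  -- when there are no upper bounds.
  witness : ∀ {n} → (Fin n → ℚ) → Partition n → ℚ
  witness x p = max (min 0ℚ (map (upperBound x) (uppers p))) (map (lowerBound x) (lowers p))

  project-complete : ∀ {n} (x : Fin n → ℚ) p → All (x ⊨_) (project p) → Holds (witness x p) x p
  project-complete x p h = U , L , All.++⁻ˡ (others p) h
    where
    resolvents = All.++⁻ʳ (others p) h
    lower≤upper : ∀ {u l} → u List.∈ uppers p → l List.∈ lowers p → lowerBound x l ≤ upperBound x u
    lower≤upper {u} {l} u∈ l∈ = to (⊕-⇔ x u l) (All.lookup resolvents (∈-cartesianProductWith⁺ _⊕_ u∈ l∈))
    U : All (λ u → witness x p ≤ upperBound x u) (uppers p)
    U = All.tabulate λ u∈ → max≤v⁺ (All.lookup (All.map⁻ (min≤xs 0ℚ (map (upperBound x) (uppers p)))) u∈)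
          (All.map⁺ (All.tabulate λ l∈ → lower≤upper u∈ l∈))
    L : All (λ l → lowerBound x l ≤ witness x p) (lowers p)
    L = All.map⁻ (xs≤max _ (map (lowerBound x) (lowers p)))

  feasible? : ∀ {n} (rs : List (Inequality n)) → Dec (Feasible rs)
  feasible? {zero}  rs = map′ ((λ ()) ,_) proj₂ (All.all? (λ r → 0ℚ ≤? proj₂ r) rs)
  feasible? {suc n} rs = map′ extend restrict (feasible? (project (partition rs)))
    where
    extend : Feasible (project (partition rs)) → Feasible rs
    extend (x , h) = witness x (partition rs) Vector.∷ x ,
      from (partition-⇔ (witness x (partition rs) Vector.∷ x) rs) (project-complete x (partition rs) h)
    restrict : Feasible rs → Feasible (project (partition rs))
    restrict (x , h) = tail x , project-sound (head x) (tail x) _ (to (partition-⇔ x rs) h)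

-- Convex hulls of finitely many points

x∉p-x : ∀ {n} (p : Subset n) x → x ∉ p ∖ x
x∉p-x (s ∷ p) zero    ()
x∉p-x (s ∷ p) (suc x) (there x∈p∖x) = x∉p-x p x x∈p∖x

module Hull {d n : ℕ} (vs : Fin n → Pt d) where

  combine : (Fin n → ℚ) → Pt d
  combine w j = Σ[<] n (λ i → w i * vs i j)

  combine-+ : ∀ v w → combine (λ i → v i + w i) ≗ λ j → combine v j + combine w j
  combine-+ v w j = trans (Σ[<]-cong n (λ i → *-distribʳ-+ (vs i j) (v i) (w i))) (Σ[<]-distrib-+ n _ _)

  combine-* : ∀ r w → combine (λ i → r * w i) ≗ λ j → r * combine w j
  combine-* r w j = trans (Σ[<]-cong n (λ i → *-assoc r (w i) (vs i j))) (*-distribˡ-Σ[<] n r _)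

  combine-single : ∀ l a → combine (single l a) ≗ λ j → a * vs l j
  combine-single l a j = Σ[<]-single-* n l a (λ i → vs i j)

  record Weighting (S : Subset n) (s : ℚ) : Set where
    field
      weight  : Fin n → ℚ
      nonNeg  : ∀ i → 0ℚ ≤ weight i
      total   : Σ[<] n weight ≡ s
      support : ∀ i → i ∉ S → weight i ≡ 0ℚ
  open Weighting public

  InHull : Subset n → ℚ → Pt d → Set
  InHull S s x = Σ (Weighting S s) λ μ → x ≗ combine (weight μ)

  module _ {S : Subset n} where

    weight≤total : ∀ {s} (μ : Weighting S s) i → weight μ i ≤ s
    weight≤total μ i = subst (weight μ i ≤_) (total μ) (term≤Σ[<] n (nonNeg μ) i)

    combine-total-zero : (μ : Weighting S 0ℚ) → combine (weight μ) ≗ λ _ → 0ℚ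
    combine-total-zero μ j = begin
      combine (weight μ) j              ≡⟨ Σ[<]-cong n (λ i → cong (_* vs i j) (weight≡0 i)) ⟩
      Σ[<] n (λ i → 0ℚ * vs i j)        ≡⟨ Σ[<]-cong n (λ i → *-zeroˡ (vs i j)) ⟩
      Σ[<] n (λ _ → 0ℚ)                 ≡⟨ Σ[<]-zero n ⟩
      0ℚ                                ∎
      where
      open ≡-Reasoning
      weight≡0 : ∀ i → weight μ i ≡ 0ℚ
      weight≡0 i = ≤-antisym (weight≤total μ i) (nonNeg μ i)

    retotal : ∀ {s s′} → s ≡ s′ → Weighting S s → Weighting S s′
    retotal s≡s′ μ = record
      { weight = weight μ ; nonNeg = nonNeg μ ; total = trans (total μ) s≡s′ ; support = support μ }

    plus : ∀ {s s′} → Weighting S s → Weighting S s′ → Weighting S (s + s′)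
    plus μ ν = record
      { weight  = λ i → weight μ i + weight ν i
      ; nonNeg  = λ i → subst (_≤ weight μ i + weight ν i) (+-identityˡ 0ℚ) (+-mono-≤ (nonNeg μ i) (nonNeg ν i))
      ; total   = trans (Σ[<]-distrib-+ n _ _) (cong₂ _+_ (total μ) (total ν))
      ; support = λ i i∉S → trans (cong₂ _+_ (support μ i i∉S) (support ν i i∉S)) (+-identityˡ 0ℚ)
      }

    scale : ∀ {s} r → 0ℚ ≤ r → Weighting S s → Weighting S (r * s)
    scale r 0≤r μ = record
      { weight  = λ i → r * weight μ i
      ; nonNeg  = λ i → *-nonNeg 0≤r (nonNeg μ i)
      ; total   = trans (*-distribˡ-Σ[<] n r _) (cong (r *_) (total μ))
      ; support = λ i i∉S → trans (cong (r *_) (support μ i i∉S)) (*-zeroʳ r)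
      }

    shift : ∀ {s l a} (μ : Weighting S s) → l ∈ S → 0ℚ ≤ weight μ l + a → Weighting S (s + a)
    shift {l = l} {a} μ l∈S 0≤μₗ+a = record
      { weight  = λ i → weight μ i + single l a i
      ; nonNeg  = nonNeg′
      ; total   = trans (Σ[<]-distrib-+ n _ _) (cong₂ _+_ (total μ) (Σ[<]-single n l a))
      ; support = λ i i∉S → trans (cong₂ _+_ (support μ i i∉S) (single-≢ l i a (λ { refl → i∉S l∈S })))
                                  (+-identityˡ 0ℚ)
      }
      where
      nonNeg′ : ∀ i → 0ℚ ≤ weight μ i + single l a i
      nonNeg′ i with i ≟ l
      ... | yes refl = subst (λ c → 0ℚ ≤ weight μ l + c) (sym (single-≡ l a)) 0≤μₗ+a
      ... | no i≢l   = subst (0ℚ ≤_) (sym (trans (cong (weight μ i +_) (single-≢ l i a i≢l)) (+-identityʳ _)))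
                             (nonNeg μ i)

    combine-shift : ∀ {s l a} (μ : Weighting S s) (l∈S : l ∈ S) (h : 0ℚ ≤ weight μ l + a) →
      combine (weight (shift μ l∈S h)) ≗ λ j → combine (weight μ) j + a * vs l j
    combine-shift {l = l} {a} μ _ _ j =
      trans (combine-+ (weight μ) (single l a) j) (cong (combine (weight μ) j +_) (combine-single l a j))

    without : ∀ {s} i (μ : Weighting S s) → weight μ i ≡ 0ℚ → Weighting (S ∖ i) s
    without i μ μᵢ≡0 = record
      { weight = weight μ ; nonNeg = nonNeg μ ; total = total μ ; support = support′ }
      where
      support′ : ∀ l → l ∉ S ∖ i → weight μ l ≡ 0ℚ
      support′ l l∉S∖i with l ≟ i
      ... | yes refl = μᵢ≡0
      ... | no l≢i   = support μ l (λ l∈S → l∉S∖i (x∈p∧x≢y⇒x∈p-y l∈S l≢i))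

  widen : ∀ {S S′ s} → S ⊆ S′ → Weighting S s → Weighting S′ s
  widen S⊆S′ μ = record
    { weight = weight μ ; nonNeg = nonNeg μ ; total = total μ ; support = λ i i∉S′ → support μ i (i∉S′ ∘ S⊆S′) }

  nonNegRows : List (Inequality n)
  nonNegRows = tabulate (λ i → single i (- 1ℚ) , 0ℚ)

  nonNegRows-⇔ : ∀ w → All (w ⊨_) nonNegRows ⇔ (∀ i → 0ℚ ≤ w i)
  nonNegRows-⇔ w = mk⇔ (λ h i → to (row-⇔ i) (All.tabulate⁻ h i)) (λ h → All.tabulate⁺ (λ i → from (row-⇔ i) (h i)))
    where
    row-⇔ : ∀ i → single i (- 1ℚ) · w ≤ 0ℚ ⇔ 0ℚ ≤ w i
    row-⇔ i = ⇔.trans (≤-congˡ-⇔ (trans (·-single i (- 1ℚ) w) (solve 1 (λ x → :- con 1ℚ :* x := :- x) refl (w i))))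
                      (neg-≤-⇔ (w i) 0ℚ)

  outsideIndicator : Subset n → Fin n → ℚ
  outsideIndicator S i with i ∈? S
  ... | yes _ = 0ℚ
  ... | no _  = 1ℚ

  hullEquations : Subset n → ℚ → Pt d → List (Inequality n)
  hullEquations S s x = ((λ _ → 1ℚ) , s) ∷ tabulate (λ i → single i (outsideIndicator S i) , 0ℚ)
                                        ++ tabulate (λ j → (λ i → vs i j) , x j)

  hullEquations-⇔ : ∀ S s x w → All (λ e → proj₁ e · w ≡ proj₂ e) (hullEquations S s x)
                              ⇔ ((Σ[<] n w ≡ s) × (∀ i → i ∉ S → w i ≡ 0ℚ) × (x ≗ combine w))
  hullEquations-⇔ S s x w = mk⇔
    (λ { (t ∷ h) → let (hS , hx) = All.++⁻ _ h in
           trans (sym ones) t , (λ i → to (support-⇔ i) (All.tabulate⁻ hS i)) , (λ j → trans (sym (All.tabulate⁻ hx j)) (point j)) })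
    (λ (t , sup , x≗) → trans ones t ∷ All.++⁺ (All.tabulate⁺ (λ i → from (support-⇔ i) (sup i)))
                                               (All.tabulate⁺ (λ j → trans (point j) (sym (x≗ j)))))
    where
    ones : (λ _ → 1ℚ) · w ≡ Σ[<] n w
    ones = Σ[<]-cong n (λ i → *-identityˡ (w i))
    point : ∀ j → (λ i → vs i j) · w ≡ combine w j
    point j = Σ[<]-cong n (λ i → *-comm (vs i j) (w i))
    support-⇔ : ∀ i → single i (outsideIndicator S i) · w ≡ 0ℚ ⇔ (i ∉ S → w i ≡ 0ℚ)
    support-⇔ i with i ∈? S
    ... | yes i∈S = mk⇔ (λ _ i∉S → contradiction i∈S i∉S) (λ _ → trans (·-single i 0ℚ w) (*-zeroˡ (w i)))
    ... | no i∉S  = mk⇔ (λ e _ → trans (sym (trans (·-single i 1ℚ w) (*-identityˡ (w i)))) e)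
                        (λ h → trans (·-single i 1ℚ w) (trans (*-identityˡ (w i)) (h i∉S)))

  InHull⇔Feasible : ∀ S s x → InHull S s x ⇔ Feasible (nonNegRows ++ equalities (hullEquations S s x))
  InHull⇔Feasible S s x = mk⇔
    (λ (μ , x≗) → weight μ , All.++⁺ (from (nonNegRows-⇔ (weight μ)) (nonNeg μ))
      (from (equalities-⇔ (weight μ) _) (from (hullEquations-⇔ S s x (weight μ)) (total μ , support μ , x≗))))
    (λ (w , h) → let (h₁ , h₂) = All.++⁻ nonNegRows h
                     (t , sup , x≗) = to (hullEquations-⇔ S s x w) (to (equalities-⇔ w _) h₂) in
      record { weight = w ; nonNeg = to (nonNegRows-⇔ w) h₁ ; total = t ; support = sup } , x≗)

  InHull? : ∀ S s x → Dec (InHull S s x)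
  InHull? S s x = Dec.map (⇔.sym (InHull⇔Feasible S s x)) (FourierMotzkin.feasible? _)

  InConv⇒InHull-⊤ : ∀ {x} → InConv vs x → InHull ⊤ 1ℚ x
  InConv⇒InHull-⊤ (w , 0≤w , Σw≡1 , x≗) =
    record { weight = w ; nonNeg = 0≤w ; total = Σw≡1 ; support = λ i i∉⊤ → contradiction ∈⊤ i∉⊤ } , x≗

  InHull⇒InConv : ∀ {S x} → InHull S 1ℚ x → InConv vs x
  InHull⇒InConv (μ , x≗) = weight μ , nonNeg μ , total μ , x≗

  generator∈InHull : ∀ {S i} → i ∈ S → InHull S 1ℚ (vs i)
  generator∈InHull {S} {i} i∈S = record
    { weight  = single i 1ℚ
    ; nonNeg  = λ l → nonNeg′ l (l ≟ i)
    ; total   = Σ[<]-single n i 1ℚ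
    ; support = λ l l∉S → single-≢ i l 1ℚ (λ { refl → l∉S i∈S })
    } , λ j → sym (trans (combine-single i 1ℚ j) (*-identityˡ (vs i j)))
    where
    nonNeg′ : ∀ l → Dec (l ≡ i) → 0ℚ ≤ single i 1ℚ l
    nonNeg′ l (yes refl) = subst (0ℚ ≤_) (sym (single-≡ i 1ℚ)) (ℕ→ℚ-nonNeg 1)
    nonNeg′ l (no l≢i)   = ≤-reflexive (sym (single-≢ i l 1ℚ l≢i))

  Spans : Subset n → Set
  Spans S = ∀ x → InConv vs x → InHull S 1ℚ x

  Irredundant : Subset n → Set
  Irredundant S = ∀ i → i ∈ S → ¬ InHull (S ∖ i) 1ℚ (vs i)

  -- Substitute the representation of vs i over S ∖ i for the vs i term of any representation.
  spans-∖ : ∀ {S i} → Spans S → i ∈ S → InHull (S ∖ i) 1ℚ (vs i) → Spans (S ∖ i)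
  spans-∖ {S} {i} spans i∈S (c , vᵢ≗) x x∈P = without i κ κᵢ≡0 , x≗
    where
    μ = proj₁ (spans x x∈P)
    μᵢ = weight μ i
    0≤μᵢ-μᵢ = ≤-reflexive (sym (+-inverseʳ μᵢ))
    cleared = shift μ i∈S 0≤μᵢ-μᵢ
    κ = retotal (solve 1 (λ m → (con 1ℚ :- m) :+ m :* con 1ℚ := con 1ℚ) refl μᵢ)
                (plus cleared (scale μᵢ (nonNeg μ i) (widen (p─q⊆p S _) c)))
    κᵢ≡0 : weight κ i ≡ 0ℚ
    κᵢ≡0 = begin
      (μᵢ + single i (- μᵢ) i) + μᵢ * weight c i   ≡⟨ cong₂ (λ a b → (μᵢ + a) + μᵢ * b) (single-≡ i (- μᵢ)) (support c i (x∉p-x S i)) ⟩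
      (μᵢ + - μᵢ) + μᵢ * 0ℚ                        ≡⟨ solve 1 (λ m → (m :- m) :+ m :* con 0ℚ := con 0ℚ) refl μᵢ ⟩
      0ℚ                                           ∎
      where open ≡-Reasoning
    x≗ : x ≗ combine (weight κ)
    x≗ j = sym (begin
      combine (weight κ) j                                         ≡⟨ combine-+ (weight cleared) _ j ⟩
      combine (weight cleared) j + combine (λ l → μᵢ * weight c l) j ≡⟨ cong₂ _+_ (combine-shift μ i∈S 0≤μᵢ-μᵢ j) (combine-* μᵢ (weight c) j) ⟩
      (combine (weight μ) j + - μᵢ * vs i j) + μᵢ * combine (weight c) j ≡⟨ cong (λ v → (combine (weight μ) j + - μᵢ * vs i j) + μᵢ * v) (vᵢ≗ j) ⟨
      (combine (weight μ) j + - μᵢ * vs i j) + μᵢ * vs i j          ≡⟨ solve 3 (λ c m v → (c :+ :- m :* v) :+ m :* v := c) refl (combine (weight μ) j) μᵢ (vs i j) ⟩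
      combine (weight μ) j                                          ≡⟨ proj₂ (spans x x∈P) j ⟨
      x j                                                           ∎)
      where open ≡-Reasoning

  Removable : Subset n → Set
  Removable S = ∃ λ i → i ∈ S × InHull (S ∖ i) 1ℚ (vs i)

  removable? : ∀ S → Dec (Removable S)
  removable? S = any? (λ i → i ∈? S ×-dec InHull? (S ∖ i) 1ℚ (vs i))

  prune : ∀ m S → ∣ S ∣ ℕ.≤ m → Spans S → Dec (Removable S) → ∃ λ S′ → Spans S′ × Irredundant S′
  prune m       S _ spans (no none) = S , spans , λ i i∈S vᵢ∈ → none (i , i∈S , vᵢ∈)
  prune zero    S ∣S∣≤0 _ (yes (i , i∈S , _)) = contradiction (ℕ.<-≤-trans (x∈p⇒∣p-x∣<∣p∣ i∈S) ∣S∣≤0) ℕ.n≮0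
  prune (suc m) S ∣S∣≤1+m spans (yes (i , i∈S , vᵢ∈)) =
    prune m (S ∖ i) (ℕ.≤-pred (ℕ.<-≤-trans (x∈p⇒∣p-x∣<∣p∣ i∈S) ∣S∣≤1+m)) (spans-∖ spans i∈S vᵢ∈) (removable? (S ∖ i))

  -- Opaque, so that type checking never unfolds the elimination procedure it runs.
  opaque
    irredundant-spanning-subset : ∃ λ S → Spans S × Irredundant S
    irredundant-spanning-subset = prune n ⊤ (∣p∣≤n ⊤) (λ _ → InConv⇒InHull-⊤) (removable? ⊤)

  weight<1⇒InHull-∖ : ∀ {S i} (γ : Weighting S 1ℚ) → i ∈ S → vs i ≗ combine (weight γ) →
                      weight γ i < 1ℚ → InHull (S ∖ i) 1ℚ (vs i)
  weight<1⇒InHull-∖ {S} {i} γ i∈S vᵢ≗ γᵢ<1 = without i ρ ρᵢ≡0 , vᵢ≗ρ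
    where
    γᵢ = weight γ i
    0≤γᵢ-γᵢ = ≤-reflexive (sym (+-inverseʳ γᵢ))
    0<1-γᵢ = p<q⇒0<q-p γᵢ<1
    r = recip (1ℚ - γᵢ) 0<1-γᵢ
    rest = shift γ i∈S 0≤γᵢ-γᵢ
    ρ = retotal (recip-inverseˡ 0<1-γᵢ) (scale r (<⇒≤ (recip-pos 0<1-γᵢ)) rest)
    ρᵢ≡0 : weight ρ i ≡ 0ℚ
    ρᵢ≡0 = trans (cong (λ c → r * (γᵢ + c)) (single-≡ i (- γᵢ))) (trans (cong (r *_) (+-inverseʳ γᵢ)) (*-zeroʳ r))
    vᵢ≗ρ : vs i ≗ combine (weight ρ)
    vᵢ≗ρ j = sym (begin
      combine (weight ρ) j                          ≡⟨ combine-* r (weight rest) j ⟩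
      r * combine (weight rest) j                   ≡⟨ cong (r *_) (combine-shift γ i∈S 0≤γᵢ-γᵢ j) ⟩
      r * (combine (weight γ) j + - γᵢ * vs i j)    ≡⟨ cong (λ v → r * (v + - γᵢ * vs i j)) (vᵢ≗ j) ⟨
      r * (vs i j + - γᵢ * vs i j)                  ≡⟨ solve 3 (λ r g v → r :* (v :+ :- g :* v) := (r :* (con 1ℚ :- g)) :* v) refl r γᵢ (vs i j) ⟩
      (r * (1ℚ - γᵢ)) * vs i j                      ≡⟨ cong (_* vs i j) (recip-inverseˡ 0<1-γᵢ) ⟩
      1ℚ * vs i j                                   ≡⟨ *-identityˡ (vs i j) ⟩
      vs i j                                        ∎)
      where open ≡-Reasoning

  weight≡1⇒combine≗ : ∀ {S i} (a : Weighting S 1ℚ) → i ∈ S → weight a i ≡ 1ℚ → combine (weight a) ≗ vs i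
  weight≡1⇒combine≗ {S} {i} a i∈S aᵢ≡1 j = begin
    combine (weight a) j                                  ≡⟨ solve 2 (λ c v → c := (c :+ :- con 1ℚ :* v) :+ v) refl (combine (weight a) j) (vs i j) ⟩
    (combine (weight a) j + - 1ℚ * vs i j) + vs i j       ≡⟨ cong (_+ vs i j) (combine-shift a i∈S 0≤aᵢ-1 j) ⟨
    combine (weight rest) j + vs i j                      ≡⟨ cong (_+ vs i j) (combine-total-zero rest j) ⟩
    0ℚ + vs i j                                           ≡⟨ +-identityˡ (vs i j) ⟩
    vs i j                                                ∎
    where
    open ≡-Reasoning
    0≤aᵢ-1 : 0ℚ ≤ weight a i + - 1ℚ
    0≤aᵢ-1 = ≤-reflexive (sym (trans (cong (_+ - 1ℚ) aᵢ≡1) (+-inverseʳ 1ℚ)))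
    rest = retotal (+-inverseʳ 1ℚ) (shift a i∈S 0≤aᵢ-1)

  convex-weighting : ∀ {S} t → 0ℚ ≤ t → t ≤ 1ℚ → Weighting S 1ℚ → Weighting S 1ℚ → Weighting S 1ℚ
  convex-weighting t 0≤t t≤1 a b =
    retotal (solve 1 (λ t → t :* con 1ℚ :+ (con 1ℚ :- t) :* con 1ℚ := con 1ℚ) refl t)
            (plus (scale t 0≤t a) (scale (1ℚ - t) (subst (_≤ 1ℚ - t) (+-inverseʳ t) (+-monoˡ-≤ (- t) t≤1)) b))

  combine-convex : ∀ {S} t 0≤t t≤1 (a b : Weighting S 1ℚ) →
    combine (weight (convex-weighting t 0≤t t≤1 a b)) ≗ λ j → t * combine (weight a) j + (1ℚ - t) * combine (weight b) j
  combine-convex t _ _ a b j = trans (combine-+ (λ i → t * weight a i) (λ i → (1ℚ - t) * weight b i) j)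
    (cong₂ _+_ (combine-* t (weight a) j) (combine-* (1ℚ - t) (weight b) j))

  irredundant⇒vertex : ∀ {S i} → Spans S → Irredundant S → i ∈ S → IsVertex (InConv vs) (vs i)
  irredundant⇒vertex {S} {i} spans irredundant i∈S = InHull⇒InConv (generator∈InHull i∈S) , extreme
    where
    extreme : ∀ x y t → InConv vs x → InConv vs y → 0ℚ < t → t < 1ℚ →
              (∀ j → vs i j ≡ t * x j + (1ℚ - t) * y j) → ∀ j → x j ≡ vs i j
    extreme x y t x∈P y∈P 0<t t<1 vᵢ≡ with spans x x∈P | spans y y∈P
    ... | a , x≗a | b , y≗b = case (<-cmp (weight γ i) 1ℚ)
      where
      γ = convex-weighting t (<⇒≤ 0<t) (<⇒≤ t<1) a b
      vᵢ≗γ : vs i ≗ combine (weight γ)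
      vᵢ≗γ j = trans (vᵢ≡ j) (sym (trans (combine-convex t (<⇒≤ 0<t) (<⇒≤ t<1) a b j)
                 (cong₂ (λ u v → t * u + (1ℚ - t) * v) (sym (x≗a j)) (sym (y≗b j)))))
      -- γ represents vs i; weight below 1 on i would put vs i in the hull of S ∖ i.
      case : Tri (weight γ i < 1ℚ) (weight γ i ≡ 1ℚ) (1ℚ < weight γ i) → ∀ j → x j ≡ vs i j
      case (tri< γᵢ<1 _ _) = contradiction (weight<1⇒InHull-∖ γ i∈S vᵢ≗γ γᵢ<1) (irredundant i i∈S)
      case (tri≈ _ γᵢ≡1 _) j = trans (x≗a j) (weight≡1⇒combine≗ a i∈S aᵢ≡1 j)
        where aᵢ≡1 = convex-combination-≡1 0<t t<1 (weight≤total a i) (weight≤total b i) γᵢ≡1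
      case (tri> _ _ 1<γᵢ) = contradiction (≤-<-trans (weight≤total γ i) 1<γᵢ) (<-irrefl refl)

  dilate⇒InHull : ∀ {S} t {x} → Spans S → Dilate t (InConv vs) x → InHull S (ℕ→ℚ t) x
  dilate⇒InHull t spans (y , y∈P , x≗ty) =
    retotal (*-identityʳ (ℕ→ℚ t)) (scale (ℕ→ℚ t) (ℕ→ℚ-nonNeg t) μ) ,
    λ j → trans (x≗ty j) (trans (cong (ℕ→ℚ t *_) (y≗ j)) (sym (combine-* (ℕ→ℚ t) (weight μ) j)))
    where
    μ = proj₁ (spans y y∈P)
    y≗ = proj₂ (spans y y∈P)

  InHull⇒dilate : ∀ {S} t {x} → 0ℚ < ℕ→ℚ t → InHull S (ℕ→ℚ t) x → Dilate t (InConv vs) x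
  InHull⇒dilate t {x} 0<t (μ , x≗) = combine (weight ν) , InHull⇒InConv (ν , λ _ → refl) , x≡t*y
    where
    r = recip (ℕ→ℚ t) 0<t
    ν = retotal (recip-inverseˡ 0<t) (scale r (<⇒≤ (recip-pos 0<t)) μ)
    x≡t*y : ∀ j → x j ≡ ℕ→ℚ t * combine (weight ν) j
    x≡t*y j = sym (begin
      ℕ→ℚ t * combine (weight ν) j       ≡⟨ cong (ℕ→ℚ t *_) (combine-* r (weight μ) j) ⟩
      ℕ→ℚ t * (r * combine (weight μ) j) ≡⟨ solve 3 (λ t r c → t :* (r :* c) := (r :* t) :* c) refl (ℕ→ℚ t) r _ ⟩
      (r * ℕ→ℚ t) * combine (weight μ) j ≡⟨ cong (_* combine (weight μ) j) (recip-inverseˡ 0<t) ⟩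
      1ℚ * combine (weight μ) j          ≡⟨ *-identityˡ _ ⟩
      combine (weight μ) j               ≡⟨ x≗ j ⟨
      x j                                ∎)
      where open ≡-Reasoning

  translate : ∀ {S s x l a} (μ : Weighting S s) → x ≗ combine (weight μ) → l ∈ S → 0ℚ ≤ weight μ l + a →
              InHull S (s + a) (λ j → x j + a * vs l j)
  translate {x = x} {l} {a} μ x≗ l∈S h =
    shift μ l∈S h , λ j → trans (cong (_+ a * vs l j) (x≗ j)) (sym (combine-shift μ l∈S h j))

  positive-weight⇒∈ : ∀ {S s i} (μ : Weighting S s) → 0ℚ < weight μ i → i ∈ S
  positive-weight⇒∈ {S} {i = i} μ 0<μᵢ with i ∈? S
  ... | yes i∈S = i∈S
  ... | no i∉S  = contradiction 0<μᵢ (<-irrefl (sym (support μ i i∉S)))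

-- Extremal values and integrality gaps

ℓ-cong : ∀ {d} (c : LPt d) {x y} → x ≗ y → ℓ c x ≡ ℓ c y
ℓ-cong {d} c x≗y = Σ[<]-cong d (λ j → cong (ℤ→ℚ (c j) *_) (x≗y j))

ℓ-translate : ∀ {d} (c : LPt d) x y a → ℓ c (λ j → x j + a * y j) ≡ ℓ c x + a * ℓ c y
ℓ-translate {d} c x y a = begin
  Σ[<] d (λ j → ℤ→ℚ (c j) * (x j + a * y j))                     ≡⟨ Σ[<]-cong d (λ j → solve 4 (λ c x a y → c :* (x :+ a :* y) := c :* x :+ a :* (c :* y)) refl (ℤ→ℚ (c j)) (x j) a (y j)) ⟩
  Σ[<] d (λ j → ℤ→ℚ (c j) * x j + a * (ℤ→ℚ (c j) * y j))         ≡⟨ Σ[<]-distrib-+ d _ _ ⟩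
  ℓ c x + Σ[<] d (λ j → a * (ℤ→ℚ (c j) * y j))                    ≡⟨ cong (ℓ c x +_) (*-distribˡ-Σ[<] d a _) ⟩
  ℓ c x + a * ℓ c y                                               ∎
  where open ≡-Reasoning

negate : ∀ {d} → LPt d → LPt d
negate c j = ℤ.- c j

ℓ-negate : ∀ {d} (c : LPt d) x → ℓ (negate c) x ≡ - ℓ c x
ℓ-negate {d} c x = trans (Σ[<]-cong d (λ j → trans (cong (_* x j) (ℤ→ℚ-homo‿- (c j))) (sym (neg-distribˡ-* (ℤ→ℚ (c j)) (x j)))))
  (neg-distrib-Σ[<] d (λ j → ℤ→ℚ (c j) * x j))

IsGreatestValue IsLeastValue : ∀ {X : Set} → (X → Set) → (X → ℚ) → ℚ → Set
IsGreatestValue R f M = (∃ λ x → R x × f x ≡ M) × (∀ x → R x → f x ≤ M)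
IsLeastValue    R f m = (∃ λ x → R x × f x ≡ m) × (∀ x → R x → m ≤ f x)

module _ {X : Set} {R R′ : X → Set} (f : X → ℚ) (δ : ℚ)
         (up   : ∀ x → R x → ∃ λ x′ → R′ x′ × f x′ ≡ f x + δ)
         (down : ∀ x′ → R′ x′ → ∃ λ x → R x × f x′ ≤ f x + δ) where

  greatest-shift : ∀ M → IsGreatestValue R f M ⇔ IsGreatestValue R′ f (M + δ)
  greatest-shift M = mk⇔ forward backward
    where
    forward : IsGreatestValue R f M → IsGreatestValue R′ f (M + δ)
    forward ((x , x∈R , fx≡M) , bound) =
      (let (x′ , x′∈R′ , fx′≡fx+δ) = up x x∈R in x′ , x′∈R′ , trans fx′≡fx+δ (cong (_+ δ) fx≡M)) ,
      λ y′ y′∈R′ → let (y , y∈R , fy′≤fy+δ) = down y′ y′∈R′ in ≤-trans fy′≤fy+δ (+-monoˡ-≤ δ (bound y y∈R))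
    backward : IsGreatestValue R′ f (M + δ) → IsGreatestValue R f M
    backward ((x′ , x′∈R′ , fx′≡M+δ) , bound′) = (x , x∈R , ≤-antisym (bound x x∈R) M≤fx) , bound
      where
      bound : ∀ y → R y → f y ≤ M
      bound y y∈R = let (y′ , y′∈R′ , fy′≡fy+δ) = up y y∈R in
        +-cancelʳ-≤ δ (subst (_≤ M + δ) fy′≡fy+δ (bound′ y′ y′∈R′))
      x = proj₁ (down x′ x′∈R′)
      x∈R = proj₁ (proj₂ (down x′ x′∈R′))
      M≤fx : M ≤ f x
      M≤fx = +-cancelʳ-≤ δ (subst (_≤ f x + δ) fx′≡M+δ (proj₂ (proj₂ (down x′ x′∈R′))))

least⇔greatest-neg : ∀ {X : Set} (R : X → Set) (f g : X → ℚ) → (∀ x → g x ≡ - f x) →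
  ∀ m → IsLeastValue R f m ⇔ IsGreatestValue R g (- m)
least⇔greatest-neg R f g g≡-f m = mk⇔
  (λ ((x , x∈R , fx≡m) , bound) → (x , x∈R , trans (g≡-f x) (cong -_ fx≡m)) ,
     λ y y∈R → subst (_≤ - m) (sym (g≡-f y)) (neg-antimono-≤ (bound y y∈R)))
  (λ ((x , x∈R , gx≡-m) , bound) → (x , x∈R , neg-injective (trans (sym (g≡-f x)) gx≡-m)) ,
     λ y y∈R → to (neg-≤-⇔ (f y) m) (subst (_≤ - m) (g≡-f y) (bound y y∈R)))

maxGap-shift : ∀ {d} {R R′ : Region d} {c : LPt d} δ →
  (∀ M → IsMaxVal R c M ⇔ IsMaxVal R′ c (M + δ)) → (∀ L → IsLatMaxVal R c L ⇔ IsLatMaxVal R′ c (L + δ)) →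
  ∀ g → IsMaxGap R c g ⇔ IsMaxGap R′ c g
maxGap-shift {R′ = R′} {c} δ values latticeValues g = mk⇔
  (λ (M , L , hM , hL , g≡M-L) → M + δ , L + δ , to (values M) hM , to (latticeValues L) hL ,
     trans g≡M-L (solve 3 (λ M L δ → M :- L := (M :+ δ) :- (L :+ δ)) refl M L δ))
  (λ (M′ , L′ , hM′ , hL′ , g≡M′-L′) → M′ - δ , L′ - δ ,
     from (values (M′ - δ)) (subst (IsMaxVal R′ c) (unshift M′) hM′) ,
     from (latticeValues (L′ - δ)) (subst (IsLatMaxVal R′ c) (unshift L′) hL′) ,
     trans g≡M′-L′ (solve 3 (λ M L δ → M :- L := (M :- δ) :- (L :- δ)) refl M′ L′ δ))
  where
  unshift : ∀ v → v ≡ v - δ + δ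
  unshift v = solve 2 (λ v δ → v := v :- δ :+ δ) refl v δ

minGap⇔maxGap-negate : ∀ {d} (R : Region d) (c : LPt d) g → IsMinGap R c g ⇔ IsMaxGap R (negate c) g
minGap⇔maxGap-negate R c g = mk⇔
  (λ (m , l , hm , hl , g≡l-m) → - m , - l , to (values m) hm , to (latticeValues l) hl ,
     trans g≡l-m (solve 2 (λ l m → l :- m := (:- m) :- (:- l)) refl l m))
  (λ (M , L , hM , hL , g≡M-L) → - M , - L ,
     from (values (- M)) (subst (IsMaxVal R (negate c)) (sym (neg-involutive M)) hM) ,
     from (latticeValues (- L)) (subst (IsLatMaxVal R (negate c)) (sym (neg-involutive L)) hL) ,
     trans g≡M-L (solve 2 (λ M L → M :- L := (:- L) :- (:- M)) refl M L))
  where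
  values = least⇔greatest-neg R (ℓ c) (ℓ (negate c)) (ℓ-negate c)
  latticeValues = least⇔greatest-neg (R ∘ embed) (ℓ c ∘ embed) (ℓ (negate c) ∘ embed) (ℓ-negate c ∘ embed)

module Periodicity (P : ℕ → Set) (T D : ℕ) (step : ∀ t → T ℕ.≤ t → P t ⇔ P (t ℕ.+ D)) where

  iterate : ∀ q t → T ℕ.≤ t → P t ⇔ P (t ℕ.+ q ℕ.* D)
  iterate zero    t T≤t = subst (λ u → P t ⇔ P u) (sym (ℕ.+-identityʳ t)) ⇔.refl
  iterate (suc q) t T≤t = ⇔.trans (iterate q t T≤t)
    (subst (λ u → P (t ℕ.+ q ℕ.* D) ⇔ P u) t+qD+D≡t+[1+q]D (step _ (ℕ.≤-trans T≤t (ℕ.m≤m+n t _))))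
    where
    t+qD+D≡t+[1+q]D : t ℕ.+ q ℕ.* D ℕ.+ D ≡ t ℕ.+ suc q ℕ.* D
    t+qD+D≡t+[1+q]D = trans (ℕ.+-assoc t _ D) (cong (t ℕ.+_) (ℕ.+-comm (q ℕ.* D) D))

  ordered : ∀ {t₁ t₂} → T ℕ.≤ t₁ → t₁ ℕ.≤ t₂ → D ℕ∣ t₂ ℕ.∸ t₁ → P t₁ ⇔ P t₂
  ordered {t₁} {t₂} T≤t₁ t₁≤t₂ (divides q t₂∸t₁≡qD) =
    subst (λ u → P t₁ ⇔ P u) (trans (cong (t₁ ℕ.+_) (sym t₂∸t₁≡qD)) (ℕ.m+[n∸m]≡n t₁≤t₂)) (iterate q t₁ T≤t₁)

  periodic : ∀ t₁ t₂ → T ℕ.≤ t₁ → T ℕ.≤ t₂ → (ℤ.+ D) ∣ℤ (ℤ.+ t₁ ℤ.- ℤ.+ t₂) → P t₁ ⇔ P t₂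
  periodic t₁ t₂ T≤t₁ T≤t₂ D∣t₁-t₂ = [ t₁≤t₂⇒ , t₂≤t₁⇒ ]′ (ℕ.≤-total t₁ t₂)
    where
    D∣∣t₁⊖t₂∣ : D ℕ∣ ℤ.∣ t₁ ℤ.⊖ t₂ ∣
    D∣∣t₁⊖t₂∣ = subst (λ z → D ℕ∣ ℤ.∣ z ∣) (ℤ.[+m]-[+n]≡m⊖n t₁ t₂) D∣t₁-t₂
    t₁≤t₂⇒ : t₁ ℕ.≤ t₂ → P t₁ ⇔ P t₂
    t₁≤t₂⇒ t₁≤t₂ = ordered T≤t₁ t₁≤t₂ (subst (D ℕ∣_) (ℤ.∣⊖∣-≤ t₁≤t₂) D∣∣t₁⊖t₂∣)
    t₂≤t₁⇒ : t₂ ℕ.≤ t₁ → P t₁ ⇔ P t₂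
    t₂≤t₁⇒ t₂≤t₁ = ⇔.sym (ordered T≤t₂ t₂≤t₁
      (subst (D ℕ∣_) (trans (ℤ.∣m⊖n∣≡∣n⊖m∣ t₁ t₂) (ℤ.∣⊖∣-≤ t₂≤t₁)) D∣∣t₁⊖t₂∣))

-- Dilations of the polytope

module Dilation {d k : ℕ} (vs : Fin (suc k) → Pt d) (D : ℕ) (0<D : 0 ℕ.< D)
                (clears : ClearsDenoms (InConv vs) D) where
  open Hull vs

  Q : ℕ → Region d
  Q t = Dilate t (InConv vs)

  Q-cong : ∀ t {x y} → x ≗ y → Q t x → Q t y
  Q-cong t x≗y (z , z∈P , x≗tz) = z , z∈P , λ j → trans (sym (x≗y j)) (x≗tz j)

  T : ℕ
  T = suc k ℕ.* D

  V : Subset (suc k)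
  V = proj₁ irredundant-spanning-subset

  V-spans : Spans V
  V-spans = proj₁ (proj₂ irredundant-spanning-subset)

  V-vertex : ∀ {l} → l ∈ V → IsVertex (InConv vs) (vs l)
  V-vertex = irredundant⇒vertex V-spans (proj₂ (proj₂ irredundant-spanning-subset))

  V-nonempty : ∃ λ i → i ∈ V
  V-nonempty =
    let (μ , _) = V-spans (vs zero) (InHull⇒InConv (generator∈InHull ∈⊤))
        (i , 0<μᵢ) = pigeonhole (suc k) (weight μ) (λ _ → 0ℚ)
                       (subst₂ _<_ (sym (Σ[<]-zero (suc k))) (sym (total μ)) (ℕ→ℚ-pos 1))
    in i , positive-weight⇒∈ μ 0<μᵢ

  ND : ℚ
  ND = ℕ→ℚ D

  0<ND : 0ℚ < ND
  0<ND = ℕ→ℚ-pos D {{ℕ.>-nonZero 0<D}}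

  latticeStep : ∀ {l} → l ∈ V → LPt d
  latticeStep l∈V j = proj₁ (clears _ (V-vertex l∈V) j)

  embed-latticeStep : ∀ {l} (l∈V : l ∈ V) → embed (latticeStep l∈V) ≗ λ j → ND * vs l j
  embed-latticeStep l∈V j = sym (proj₂ (clears _ (V-vertex l∈V) j))

  step-up : ∀ t {x l} → l ∈ V → Q t x → Q (t ℕ.+ D) (λ j → x j + ND * vs l j)
  step-up t {x} {l} l∈V x∈Qt =
    InHull⇒dilate (t ℕ.+ D) 0<t+D
      (subst (λ s → InHull V s (λ j → x j + ND * vs l j)) (sym (ℕ→ℚ-homo-+ t D)) (translate μ x≗ l∈V 0≤μₗ+ND))
    where
    μ = proj₁ (dilate⇒InHull t V-spans x∈Qt)
    x≗ = proj₂ (dilate⇒InHull t V-spans x∈Qt)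
    0≤μₗ+ND = subst (_≤ weight μ l + ND) (+-identityˡ 0ℚ) (+-mono-≤ (nonNeg μ l) (<⇒≤ 0<ND))
    0<t+D = <-≤-trans 0<ND (ℕ→ℚ-mono-≤ (ℕ.m≤n+m D t))

  -- Pigeonhole: a total weight t + D > (k+1)·D puts weight above D on some point of V.
  step-down : ∀ t {x} → T ℕ.≤ t → Q (t ℕ.+ D) x → ∃ λ l → l ∈ V × Q t (λ j → x j + - ND * vs l j)
  step-down t {x} T≤t x∈Q = l , l∈V ,
    InHull⇒dilate t 0<t
      (subst (λ s → InHull V s (λ j → x j + - ND * vs l j)) t+D-D≡t (translate μ x≗ l∈V (<⇒≤ (p<q⇒0<q-p ND<μₗ))))
    where
    μ = proj₁ (dilate⇒InHull (t ℕ.+ D) V-spans x∈Q)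
    x≗ = proj₂ (dilate⇒InHull (t ℕ.+ D) V-spans x∈Q)
    kD≤t = ℕ.≤-trans (ℕ.m≤m+n D (k ℕ.* D)) T≤t
    0<t = <-≤-trans 0<ND (ℕ→ℚ-mono-≤ kD≤t)
    KND<Σμ : Σ[<] (suc k) (λ _ → ND) < Σ[<] (suc k) (weight μ)
    KND<Σμ = begin-strict
      Σ[<] (suc k) (λ _ → ND)   ≡⟨ Σ[<]-const (suc k) D ⟩
      ℕ→ℚ T                     ≤⟨ ℕ→ℚ-mono-≤ T≤t ⟩
      ℕ→ℚ t                     ≡⟨ +-identityʳ (ℕ→ℚ t) ⟨
      ℕ→ℚ t + 0ℚ                <⟨ +-monoʳ-< (ℕ→ℚ t) 0<ND ⟩
      ℕ→ℚ t + ND                ≡⟨ ℕ→ℚ-homo-+ t D ⟨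
      ℕ→ℚ (t ℕ.+ D)             ≡⟨ total μ ⟨
      Σ[<] (suc k) (weight μ)   ∎
      where open ≤-Reasoning
    l = proj₁ (pigeonhole (suc k) (weight μ) (λ _ → ND) KND<Σμ)
    ND<μₗ = proj₂ (pigeonhole (suc k) (weight μ) (λ _ → ND) KND<Σμ)
    l∈V = positive-weight⇒∈ μ (<-trans 0<ND ND<μₗ)
    t+D-D≡t : ℕ→ℚ (t ℕ.+ D) + - ND ≡ ℕ→ℚ t
    t+D-D≡t = trans (cong (_+ - ND) (ℕ→ℚ-homo-+ t D)) (solve 2 (λ t d → t :+ d :- d := t) refl (ℕ→ℚ t) ND)

  module _ (c : LPt d) where

    maximiser : ∃ λ i → i ∈ V × (∀ {l} → l ∈ V → ℓ c (vs l) ≤ ℓ c (vs i))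
    maximiser = argmax-on (λ i → ℓ c (vs i)) (proj₂ V-nonempty)

    δ : ℚ
    δ = ND * ℓ c (vs (proj₁ maximiser))

    down-value : ∀ {l} → l ∈ V → ∀ x → ℓ c x ≤ ℓ c (λ j → x j + - ND * vs l j) + δ
    down-value {l} l∈V x = begin
      ℓ c x                                         ≡⟨ solve 3 (λ u n v → u := (u :+ :- n :* v) :+ n :* v) refl (ℓ c x) ND (ℓ c (vs l)) ⟩
      (ℓ c x + - ND * ℓ c (vs l)) + ND * ℓ c (vs l) ≤⟨ +-monoʳ-≤ (ℓ c x + - ND * ℓ c (vs l))
                                                         (*-monoˡ-≤-nonNeg ND {{nonNegative (<⇒≤ 0<ND)}}
                                                           (proj₂ (proj₂ maximiser) l∈V)) ⟩
      (ℓ c x + - ND * ℓ c (vs l)) + δ               ≡⟨ cong (_+ δ) (ℓ-translate c x (vs l) (- ND)) ⟨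
      ℓ c (λ j → x j + - ND * vs l j) + δ           ∎
      where open ≤-Reasoning

    maxVal-step : ∀ t → T ℕ.≤ t → ∀ M → IsMaxVal (Q t) c M ⇔ IsMaxVal (Q (t ℕ.+ D)) c (M + δ)
    maxVal-step t T≤t = greatest-shift (ℓ c) δ
      (λ x x∈Q → _ , step-up t (proj₁ (proj₂ maximiser)) x∈Q , ℓ-translate c x _ ND)
      (λ x x∈Q → let (l , l∈V , x′∈Q) = step-down t T≤t x∈Q in _ , x′∈Q , down-value l∈V x)

    latMaxVal-step : ∀ t → T ℕ.≤ t → ∀ L → IsLatMaxVal (Q t) c L ⇔ IsLatMaxVal (Q (t ℕ.+ D)) c (L + δ)
    latMaxVal-step t T≤t = greatest-shift (ℓ c ∘ embed) δ up (λ z z∈Q → down z (step-down t T≤t z∈Q))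
      where
      i = proj₁ maximiser
      i∈V = proj₁ (proj₂ maximiser)
      up : ∀ z → Q t (embed z) → ∃ λ z′ → Q (t ℕ.+ D) (embed z′) × ℓ c (embed z′) ≡ ℓ c (embed z) + δ
      up z z∈Q = (λ j → z j ℤ.+ latticeStep i∈V j) , Q-cong (t ℕ.+ D) (sym ∘ embed-+) (step-up t i∈V z∈Q) ,
                 trans (ℓ-cong c embed-+) (ℓ-translate c (embed z) (vs i) ND)
        where
        embed-+ : embed (λ j → z j ℤ.+ latticeStep i∈V j) ≗ λ j → embed z j + ND * vs i j
        embed-+ j = trans (ℤ→ℚ-homo-+ (z j) (latticeStep i∈V j)) (cong (embed z j +_) (embed-latticeStep i∈V j))
      down : ∀ z → (∃ λ l → l ∈ V × Q t (λ j → embed z j + - ND * vs l j)) →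
             ∃ λ z′ → Q t (embed z′) × ℓ c (embed z) ≤ ℓ c (embed z′) + δ
      down z (l , l∈V , x′∈Q) = (λ j → z j ℤ.- latticeStep l∈V j) , Q-cong t (sym ∘ embed--) x′∈Q ,
                                subst (λ v → ℓ c (embed z) ≤ v + δ) (sym (ℓ-cong c embed--)) (down-value l∈V (embed z))
        where
        embed-- : embed (λ j → z j ℤ.- latticeStep l∈V j) ≗ λ j → embed z j + - ND * vs l j
        embed-- j = begin
          ℤ→ℚ (z j ℤ.+ ℤ.- latticeStep l∈V j)         ≡⟨ ℤ→ℚ-homo-+ (z j) (ℤ.- latticeStep l∈V j) ⟩
          embed z j + ℤ→ℚ (ℤ.- latticeStep l∈V j)     ≡⟨ cong (embed z j +_) (ℤ→ℚ-homo‿- (latticeStep l∈V j)) ⟩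
          embed z j + - embed (latticeStep l∈V) j     ≡⟨ cong (λ v → embed z j + - v) (embed-latticeStep l∈V j) ⟩
          embed z j + - (ND * vs l j)                 ≡⟨ cong (embed z j +_) (neg-distribˡ-* ND (vs l j)) ⟩
          embed z j + - ND * vs l j                   ∎
          where open ≡-Reasoning

    maxGap-step : ∀ t → T ℕ.≤ t → ∀ g → IsMaxGap (Q t) c g ⇔ IsMaxGap (Q (t ℕ.+ D)) c g
    maxGap-step t T≤t = maxGap-shift {c = c} δ (maxVal-step t T≤t) (latMaxVal-step t T≤t)

    maxGap-periodic : ∀ g t₁ t₂ → T ℕ.≤ t₁ → T ℕ.≤ t₂ → (ℤ.+ D) ∣ℤ (ℤ.+ t₁ ℤ.- ℤ.+ t₂) →
                      IsMaxGap (Q t₁) c g ⇔ IsMaxGap (Q t₂) c g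
    maxGap-periodic g = Periodicity.periodic (λ t → IsMaxGap (Q t) c g) T D (λ t T≤t → maxGap-step t T≤t g)

corollary4p4 : ∀ (d k : ℕ) (vs : Fin (suc k) → Pt d) (D : ℕ) →
    IsDenominator (InConv vs) D → (c : LPt d) →
    ∃ λ (T : ℕ) → ∀ (t₁ t₂ : ℕ) → t₁ ℕ.≥ T → t₂ ℕ.≥ T → (ℤ.+ D) ∣ℤ (ℤ.+ t₁ ℤ.- ℤ.+ t₂) →
    (∀ (g : ℚ) → IsMaxGap (Dilate t₁ (InConv vs)) c g ⇔ IsMaxGap (Dilate t₂ (InConv vs)) c g)
    × (∀ (g : ℚ) → IsMinGap (Dilate t₁ (InConv vs)) c g ⇔ IsMinGap (Dilate t₂ (InConv vs)) c g)
corollary4p4 d k vs D (0<D , clears , _) c = T , λ t₁ t₂ T≤t₁ T≤t₂ D∣t₁-t₂ →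
  (λ g → maxGap-periodic c g t₁ t₂ T≤t₁ T≤t₂ D∣t₁-t₂) ,
  (λ g → ⇔.trans (minGap⇔maxGap-negate (Q t₁) c g)
           (⇔.trans (maxGap-periodic (negate c) g t₁ t₂ T≤t₁ T≤t₂ D∣t₁-t₂)
                    (⇔.sym (minGap⇔maxGap-negate (Q t₂) c g))))
  where open Dilation vs D 0<D clears
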